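{- Let $G$ be a finite connected graph which is not a tree. If the length of the longest cycle in $G$ is at most $4$, then $G$ has no good vertex.
   Context: All graphs are finite, simple and undirected. For a connected graph $G=(V,E)$, the Wiener index is $W(G)=\sum_{\{u,v\}\subseteq V}\mathrm{dist}_G(u,v)$, the sum over all unordered pairs of distinct vertices; the Wiener index of a disconnected graph is defined to be $+\infty$. A vertex $v$ of a connected graph $G$ is called good if $W(G)=W(G-v)$. -}

module Defs where

open import Data.Nat using (ℕ; zero; suc; _+_; _≤_; _<_)
open import Data.Nat.Properties using (_<?_)
open import Data.Bool using (Bool; true; false; if_then_else_)
open import Data.Fin using (Fin; toℕ; punchIn)
open import Data.List using (List; map; allFin)
open import Data.Nat.ListAction using (sum)
open import Data.Product using (Σ; _×_; ∃)
open import Function.Definitions using (Injective)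
open import Relation.Binary.PropositionalEquality using (_≡_; cong₂)
open import Relation.Nullary using (¬_; does)

record Graph (n : ℕ) : Set where
  field
    adj    : Fin n → Fin n → Bool
    sym    : ∀ u v → adj u v ≡ adj v u
    irrefl : ∀ u → adj u u ≡ false
open Graph public

Adj : ∀ {n} → Graph n → Fin n → Fin n → Set
Adj G u v = adj G u v ≡ true

data Walk {n : ℕ} (G : Graph n) : Fin n → Fin n → ℕ → Set where
  here : ∀ {u} → Walk G u u 0
  step : ∀ {u w v k} → Adj G u w → Walk G w v k → Walk G u v (suc k)

Connected : ∀ {n} → Graph n → Set
Connected {n} G = (u v : Fin n) → ∃ λ k → Walk G u v k

IsDist : ∀ {n} → Graph n → Fin n → Fin n → ℕ → Set
IsDist G u v d = Walk G u v d × (∀ k → Walk G u v k → d ≤ k)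

pairSum : ∀ {n} → (Fin n → Fin n → ℕ) → ℕ
pairSum {n} f =
  sum (map (λ u → sum (map (λ v → if does (toℕ u <? toℕ v) then f u v else 0) (allFin n))) (allFin n))

-- IsWiener G w : W(G) is finite and equals w, i.e. G is connected and the
-- sum of distances over unordered pairs is w.  (W(G) = +∞ for disconnected G
-- means IsWiener G w holds for no w.)
IsWiener : ∀ {n} → Graph n → ℕ → Set
IsWiener {n} G w =
  Σ (Fin n → Fin n → ℕ) λ d → ((u v : Fin n) → IsDist G u v (d u v)) × (w ≡ pairSum d)

delete : ∀ {m} → Graph (suc m) → Fin (suc m) → Graph m
delete G v = record
  { adj    = λ i j → adj G (punchIn v i) (punchIn v j)
  ; sym    = λ i j → sym G (punchIn v i) (punchIn v j)
  ; irrefl = λ i → irrefl G (punchIn v i)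
  }

Good : ∀ {m} → Graph (suc m) → Fin (suc m) → Set
Good G v = Connected G × ∃ λ w → IsWiener G w × IsWiener (delete G v) w

Cycle : ∀ {n} → Graph n → ℕ → Set
Cycle {n} G k =
  3 ≤ k × Σ (Fin k → Fin n) λ c →
    Injective _≡_ _≡_ c
    × (∀ i j → suc (toℕ i) ≡ toℕ j → Adj G (c i) (c j))
    × (∀ i j → toℕ i ≡ 0 → suc (toℕ j) ≡ k → Adj G (c j) (c i))

IsTree : ∀ {n} → Graph n → Set
IsTree G = Connected G × (∀ k → ¬ Cycle G k)

-- If v were good, G - v would be connected and would keep all distances of G: a shortest
-- walk through v passes a — v — b for two neighbours a, b of v, and a shortest a–b path in
-- G - v of length ℓ closes through v to a cycle of length ℓ + 2 ≤ 4, so the detour can be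
-- replaced by one of length at most 2 avoiding v.  Hence W(G - v) is W(G) minus the positive
-- sum of the distances from v.  The one-vertex graph, where that sum is empty, is a tree.

module Submission where

open import Defs hiding (sym)
import Defs
open import Data.Nat using (ℕ; zero; suc; _+_; _≤_; _<_; z≤n; s≤s)
open import Data.Nat.Properties hiding (_≟_)
import Data.Nat.ListAction as ListAction
open import Data.Bool using (if_then_else_)
open import Data.Fin using (Fin; toℕ; punchIn; punchOut; zero; suc; _≟_)
open import Data.Fin.Properties
  using (toℕ-injective; punchIn-injective; punchInᵢ≢i; punchIn-punchOut; injective⇒≤)
open import Data.List using (map; allFin; tabulate)
open import Data.List.Properties using (map-tabulate)
open import Data.Product using (∃; _×_; _,_; proj₁; proj₂)
open import Function using (_∘_; id)
open import Function.Definitions using (Injective)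
open import Relation.Binary.Definitions using (tri<; tri≈; tri>)
open import Relation.Binary.PropositionalEquality
open import Relation.Nullary using (¬_; does; yes; no; contradiction)
open import Relation.Nullary.Decidable using (dec-true)
open import Algebra.Properties.CommutativeMonoid.Sum +-0-commutativeMonoid
  using (sum-syntax; sum-remove; ∑-distrib-+; sum-cong-≗)

private
  variable
    n k l : ℕ
    G : Graph n
    u v w x y : Fin n

sum-map-allFin : (g : Fin n → ℕ) → ListAction.sum (map g (allFin n)) ≡ ∑[ i < n ] g i
sum-map-allFin {n} g = trans (cong ListAction.sum (map-tabulate id g)) (sum-tabulate g)
  where
  sum-tabulate : ∀ {n} (g : Fin n → ℕ) → ListAction.sum (tabulate g) ≡ ∑[ i < n ] g i
  sum-tabulate {zero}  g = refl
  sum-tabulate {suc n} g = cong (g zero +_) (sum-tabulate (g ∘ suc))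

∑-term-≤ : (t : Fin n → ℕ) (i : Fin n) → t i ≤ ∑[ j < n ] t j
∑-term-≤ {suc n} t i = ≤-trans (m≤m+n (t i) _) (≤-reflexive (sym (sum-remove {i = i} t)))

upper : (Fin n → Fin n → ℕ) → Fin n → Fin n → ℕ
upper f u w = if does (toℕ u <? toℕ w) then f u w else 0

upper-< : (f : Fin n → Fin n → ℕ) → toℕ u < toℕ w → upper f u w ≡ f u w
upper-< {u = u} {w} f u<w = cong (if_then f u w else 0) (dec-true (toℕ u <? toℕ w) u<w)

pairSum≡∑∑ : (f : Fin n → Fin n → ℕ) → pairSum f ≡ ∑[ u < n ] ∑[ w < n ] upper f u w
pairSum≡∑∑ {n} f = begin
  ListAction.sum (map (λ u → ListAction.sum (map (upper f u) (allFin n))) (allFin n))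
    ≡⟨ sum-map-allFin (λ u → ListAction.sum (map (upper f u) (allFin n))) ⟩
  ∑[ u < n ] ListAction.sum (map (upper f u) (allFin n))
    ≡⟨ sum-cong-≗ (sum-map-allFin ∘ upper f) ⟩
  ∑[ u < n ] ∑[ w < n ] upper f u w ∎
  where open ≡-Reasoning

pairSum-cong : {f g : Fin n → Fin n → ℕ} → (∀ u w → f u w ≡ g u w) → pairSum f ≡ pairSum g
pairSum-cong {f = f} {g} f≗g = begin
  pairSum f                         ≡⟨ pairSum≡∑∑ f ⟩
  ∑[ u < _ ] ∑[ w < _ ] upper f u w ≡⟨ sum-cong-≗ (λ u → sum-cong-≗ (upper-cong u)) ⟩
  ∑[ u < _ ] ∑[ w < _ ] upper g u w ≡⟨ pairSum≡∑∑ g ⟨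
  pairSum g                         ∎
  where
  open ≡-Reasoning
  upper-cong : ∀ u w → upper f u w ≡ upper g u w
  upper-cong u w = cong (if does (toℕ u <? toℕ w) then_else 0) (f≗g u w)

does-punchIn-<? : (p : Fin (suc n)) (i j : Fin n) →
                  does (toℕ (punchIn p i) <? toℕ (punchIn p j)) ≡ does (toℕ i <? toℕ j)
does-punchIn-<? zero    i       j       = refl
does-punchIn-<? (suc p) zero    zero    = refl
does-punchIn-<? (suc p) zero    (suc j) = refl
does-punchIn-<? (suc p) (suc i) zero    = refl
does-punchIn-<? (suc p) (suc i) (suc j) = does-punchIn-<? p i j

pairSum-punchIn : (f : Fin (suc n) → Fin (suc n) → ℕ) (p : Fin (suc n)) →
  pairSum f ≡ (∑[ w < suc n ] upper f p w + ∑[ i < n ] upper f (punchIn p i) p)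
              + pairSum (λ i j → f (punchIn p i) (punchIn p j))
pairSum-punchIn {n} f p = begin
  pairSum f
    ≡⟨ pairSum≡∑∑ f ⟩
  ∑[ u < suc n ] ∑[ w < suc n ] upper f u w
    ≡⟨ sum-remove {i = p} (λ u → ∑[ w < suc n ] upper f u w) ⟩
  Sₚ + ∑[ i < n ] ∑[ w < suc n ] upper f (punchIn p i) w
    ≡⟨ cong (Sₚ +_) (sum-cong-≗ (λ i → sum-remove {i = p} (upper f (punchIn p i)))) ⟩
  Sₚ + ∑[ i < n ] (upper f (punchIn p i) p + ∑[ j < n ] upper f (punchIn p i) (punchIn p j))
    ≡⟨ cong (Sₚ +_) (∑-distrib-+ (λ i → upper f (punchIn p i) p) _) ⟩
  Sₚ + (Tₚ + ∑[ i < n ] ∑[ j < n ] upper f (punchIn p i) (punchIn p j))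
    ≡⟨ +-assoc Sₚ Tₚ _ ⟨
  Sₚ + Tₚ + ∑[ i < n ] ∑[ j < n ] upper f (punchIn p i) (punchIn p j)
    ≡⟨ cong (Sₚ + Tₚ +_) (sum-cong-≗ λ i → sum-cong-≗ λ j →
         cong (if_then f (punchIn p i) (punchIn p j) else 0) (does-punchIn-<? p i j)) ⟩
  Sₚ + Tₚ + ∑[ i < n ] ∑[ j < n ] upper (λ i j → f (punchIn p i) (punchIn p j)) i j
    ≡⟨ cong (Sₚ + Tₚ +_) (pairSum≡∑∑ (λ i j → f (punchIn p i) (punchIn p j))) ⟨
  Sₚ + Tₚ + pairSum (λ i j → f (punchIn p i) (punchIn p j)) ∎
  where
  open ≡-Reasoning
  Sₚ = ∑[ w < suc n ] upper f p w
  Tₚ = ∑[ i < n ] upper f (punchIn p i) p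

upper-pair-pos : (f : Fin n → Fin n → ℕ) → (∀ u w → u ≢ w → 0 < f u w) →
                 u ≢ w → 0 < upper f u w + upper f w u
upper-pair-pos {u = u} {w} f f-pos u≢w with <-cmp (toℕ u) (toℕ w)
... | tri< u<w _ _ = ≤-trans (f-pos u w u≢w) (≤-trans (≤-reflexive (sym (upper-< f u<w))) (m≤m+n _ _))
... | tri≈ _ u≡w _ = contradiction (toℕ-injective u≡w) u≢w
... | tri> _ _ w<u = ≤-trans (f-pos w u (u≢w ∘ sym)) (≤-trans (≤-reflexive (sym (upper-< f w<u))) (m≤n+m _ _))

pairSum-punchIn-< : (f : Fin (suc (suc n)) → Fin (suc (suc n)) → ℕ) → (∀ u w → u ≢ w → 0 < f u w) →
                    (p : Fin (suc (suc n))) → pairSum (λ i j → f (punchIn p i) (punchIn p j)) < pairSum f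
pairSum-punchIn-< {n} f f-pos p = begin-strict
  pairSum f′
    <⟨ m<n+m (pairSum f′) star-pos ⟩
  (∑[ w < suc (suc n) ] upper f p w + ∑[ i < suc n ] upper f (punchIn p i) p) + pairSum f′
    ≡⟨ pairSum-punchIn f p ⟨
  pairSum f ∎
  where
  open ≤-Reasoning
  f′ = λ i j → f (punchIn p i) (punchIn p j)
  q = punchIn p zero
  star-pos : 0 < ∑[ w < suc (suc n) ] upper f p w + ∑[ i < suc n ] upper f (punchIn p i) p
  star-pos = ≤-trans (upper-pair-pos f f-pos (punchInᵢ≢i p zero ∘ sym))
               (+-mono-≤ (∑-term-≤ (upper f p) q) (∑-term-≤ (λ i → upper f (punchIn p i) p) zero))

_++ʷ_ : Walk G u w k → Walk G w v l → Walk G u v (k + l)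
here     ++ʷ Q = Q
step e P ++ʷ Q = step e (P ++ʷ Q)

walk-length-pos : u ≢ v → Walk G u v k → 0 < k
walk-length-pos u≢v here       = contradiction refl u≢v
walk-length-pos u≢v (step _ _) = s≤s z≤n

vertexAt : {G : Graph n} → Walk G u v k → Fin (suc k) → Fin n
vertexAt {u = u} _ zero     = u
vertexAt (step _ P) (suc i) = vertexAt P i

vertexAt-last : (P : Walk G u v k) (i : Fin (suc k)) → toℕ i ≡ k → vertexAt P i ≡ v
vertexAt-last here       zero    _  = refl
vertexAt-last (step _ P) (suc i) eq = vertexAt-last P i (suc-injective eq)

vertexAt-adjacent : (P : Walk G u v k) (i j : Fin (suc k)) → suc (toℕ i) ≡ toℕ j →
                    Adj G (vertexAt P i) (vertexAt P j)
vertexAt-adjacent (step e P) zero    (suc zero) _  = e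
vertexAt-adjacent (step e P) (suc i) (suc j)    eq = vertexAt-adjacent P i j (suc-injective eq)

suffix : (P : Walk G u v k) (i : Fin (suc k)) → ∃ λ l → l ≤ k × Walk G (vertexAt P i) v l
suffix P          zero    = _ , ≤-refl , P
suffix (step _ P) (suc i) with suffix P i
... | l , l≤k , Q = l , m≤n⇒m≤1+n l≤k , Q

shortcut : (P : Walk G u v k) (i j : Fin (suc k)) → toℕ i < toℕ j → vertexAt P i ≡ vertexAt P j →
           ∃ λ l → l < k × Walk G u v l
shortcut (step e P) zero (suc j) _ refl with suffix P j
... | l , l≤k , Q = l , s≤s l≤k , Q
shortcut (step e P) (suc i) (suc j) (s≤s i<j) eq with shortcut P i j i<j eq
... | l , l<k , Q = suc l , s≤s l<k , step e Q

shortest-vertexAt-injective : (P : Walk G u v k) → (∀ l → Walk G u v l → k ≤ l) →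
                              Injective _≡_ _≡_ (vertexAt P)
shortest-vertexAt-injective P shortest {i} {j} eq with <-cmp (toℕ i) (toℕ j)
... | tri≈ _ i≡j _ = toℕ-injective i≡j
... | tri< i<j _ _ = let l , l<k , Q = shortcut P i j i<j eq in contradiction (shortest l Q) (<⇒≱ l<k)
... | tri> _ _ j<i = let l , l<k , Q = shortcut P j i j<i (sym eq) in contradiction (shortest l Q) (<⇒≱ l<k)

Circumference≤ : Graph n → ℕ → Set
Circumference≤ G c = ∀ k → Cycle G k → k ≤ c

path-closes-to-cycle : (P : Walk G u v (suc k)) → Injective _≡_ _≡_ (vertexAt P) →
                       (∀ i → vertexAt P i ≢ x) → Adj G x u → Adj G v x → Cycle G (suc (suc (suc k)))
path-closes-to-cycle {G = G} {k = k} {x = x} P P-inj x∉P x~u v~x =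
  s≤s (s≤s (s≤s z≤n)) , c , c-injective , c-adjacent , c-closes
  where
  c : Fin (suc (suc (suc k))) → Fin _
  c zero    = x
  c (suc i) = vertexAt P i
  c-injective : Injective _≡_ _≡_ c
  c-injective {zero}  {zero}  _  = refl
  c-injective {zero}  {suc j} eq = contradiction (sym eq) (x∉P j)
  c-injective {suc i} {zero}  eq = contradiction eq (x∉P i)
  c-injective {suc i} {suc j} eq = cong suc (P-inj eq)
  c-adjacent : ∀ i j → suc (toℕ i) ≡ toℕ j → Adj G (c i) (c j)
  c-adjacent zero    (suc zero) _  = x~u
  c-adjacent (suc i) (suc j)    eq = vertexAt-adjacent P i j (suc-injective eq)
  c-closes : ∀ i j → toℕ i ≡ 0 → suc (toℕ j) ≡ suc (suc (suc k)) → Adj G (c j) (c i)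
  c-closes zero zero    _ ()
  c-closes zero (suc j) _ eq =
    subst (λ y → Adj G y x) (sym (vertexAt-last P j (suc-injective (suc-injective eq)))) v~x

module VertexDeletion {m} (G : Graph (suc m)) (v : Fin (suc m)) where

  G-v : Graph m
  G-v = delete G v

  lift : {i j : Fin m} → Walk G-v i j k → Walk G (punchIn v i) (punchIn v j) k
  lift here       = here
  lift (step e P) = step e (lift P)

  vertexAt-lift : {i j : Fin m} (P : Walk G-v i j k) (t : Fin (suc k)) →
                  vertexAt (lift P) t ≡ punchIn v (vertexAt P t)
  vertexAt-lift _          zero    = refl
  vertexAt-lift (step _ P) (suc t) = vertexAt-lift P t

  neighbours-distance-≤ : ∀ {c l} {i j : Fin m} → Circumference≤ G (2 + c) → IsDist G-v i j l →
                     Adj G v (punchIn v i) → Adj G v (punchIn v j) → l ≤ c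
  neighbours-distance-≤ {l = zero}  _    _            _   _   = z≤n
  neighbours-distance-≤ {l = suc l} circ (P , shortest) v~i v~j =
    +-cancelˡ-≤ 2 _ _ (circ _ (path-closes-to-cycle (lift P) lift-injective avoids-v v~i j~v))
    where
    lift-injective : Injective _≡_ _≡_ (vertexAt (lift P))
    lift-injective {s} {t} eq = shortest-vertexAt-injective P shortest
      (punchIn-injective v _ _ (trans (sym (vertexAt-lift P s)) (trans eq (vertexAt-lift P t))))
    avoids-v : ∀ t → vertexAt (lift P) t ≢ v
    avoids-v t eq = punchInᵢ≢i v _ (trans (sym (vertexAt-lift P t)) eq)
    j~v : Adj G (punchIn v _) v
    j~v = trans (Defs.sym G _ v) v~j

  module _ (circ : Circumference≤ G 4)
           (d : Fin m → Fin m → ℕ) (d-dist : ∀ i j → IsDist G-v i j (d i j)) where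

    avoid-v : {i j : Fin m} → Walk G x y k → x ≡ punchIn v i → y ≡ punchIn v j →
              ∃ λ l → l ≤ k × Walk G-v i j l
    avoid-v here x≡i y≡j =
      0 , z≤n , subst (λ z → Walk G-v _ z 0) (punchIn-injective v _ _ (trans (sym x≡i) y≡j)) here
    avoid-v (step {w = w} e P) x≡i y≡j with v ≟ w
    ... | no v≢w with avoid-v P (sym (punchIn-punchOut v≢w)) y≡j
    ...   | l , l≤k , Q = suc l , s≤s l≤k , step (subst₂ (Adj G) x≡i (sym (punchIn-punchOut v≢w)) e) Q
    avoid-v (step e here) x≡i y≡j | yes refl = contradiction (sym y≡j) (punchInᵢ≢i v _)
    avoid-v {i = i} (step e (step {w = b} e′ P)) x≡i y≡j | yes refl with v ≟ b
    ... | yes refl = contradiction (trans (sym e′) (irrefl G v)) λ ()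
    ... | no v≢b with avoid-v P (sym (punchIn-punchOut v≢b)) y≡j
    ...   | l , l≤k , Q = d i b′ + l , +-mono-≤ detour≤2 l≤k , proj₁ (d-dist i b′) ++ʷ Q
      where
      b′ = punchOut v≢b
      detour≤2 : d i b′ ≤ 2
      detour≤2 = neighbours-distance-≤ circ (d-dist i b′)
        (trans (Defs.sym G v _) (subst (λ z → Adj G z v) x≡i e))
        (subst (Adj G v) (sym (punchIn-punchOut v≢b)) e′)

    distance-preserved : (D : Fin (suc m) → Fin (suc m) → ℕ) → (∀ u w → IsDist G u w (D u w)) →
                         ∀ i j → d i j ≡ D (punchIn v i) (punchIn v j)
    distance-preserved D D-dist i j with avoid-v (proj₁ (D-dist (punchIn v i) (punchIn v j))) refl refl
    ... | l , l≤D , Q = ≤-antisym (≤-trans (proj₂ (d-dist i j) l Q) l≤D)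
                                  (proj₂ (D-dist _ _) _ (lift (proj₁ (d-dist i j))))

cycle-length≤order : {G : Graph n} → Cycle G k → k ≤ n
cycle-length≤order (_ , _ , c-injective , _) = injective⇒≤ c-injective

dist-pos : IsDist G u w k → u ≢ w → 0 < k
dist-pos (P , _) u≢w = walk-length-pos u≢w P

theorem4 : (m : ℕ) (G : Graph (suc m)) → Connected G → ¬ IsTree G
    → (∀ k → Cycle G k → k ≤ 4)
    → (v : Fin (suc m)) → ¬ Good G v
theorem4 zero G connected not-tree _ _ _ =
  not-tree (connected , λ _ C →
    contradiction (≤-trans (proj₁ C) (cycle-length≤order {G = G} C)) λ { (s≤s ()) })
theorem4 (suc m) G _ _ circ v (_ , w , (D , D-dist , w≡WG) , (d , d-dist , w≡WG-v)) =
  <-irrefl refl (begin-strict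
  pairSum d                                        ≡⟨ pairSum-cong (distance-preserved circ d d-dist D D-dist) ⟩
  pairSum (λ i j → D (punchIn v i) (punchIn v j))  <⟨ pairSum-punchIn-< D (λ u w → dist-pos (D-dist u w)) v ⟩
  pairSum D                                        ≡⟨ trans (sym w≡WG) w≡WG-v ⟩
  pairSum d                                        ∎)
  where
  open VertexDeletion G v
  open ≤-Reasoning
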